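{- Let $G=(V,W,E)$ be a bipartite graph, let $Y\subseteq W$ be closed and let $\mathfrak u\in W$ have distance at least $4$ to $Y$ in $G$. Then $\mathrm{cl}(Y\cup\{\mathfrak u\})=Y\cup\{\mathfrak u\}$ and $\{\mathfrak u\}$ is a (singleton) component of $Y\cup\{\mathfrak u\}$.
   Context: For $X\subseteq W$, the attractor is $\mathrm{Att}(X)=X\cup\bigcup\{N_G(\mathfrak v):\mathfrak v\in V,\ |N_G(\mathfrak v)\setminus X|\le 1\}$; $X$ is closed if $X=\mathrm{Att}(X)$, and $\mathrm{cl}(X)$ is the inclusion-wise minimal closed superset of $X$. The feet-induced subgraph is $G^{\mathrm{feet}}[X]=G[X\cup\{\mathfrak v\in V:N_G(\mathfrak v)\subseteq X\}]$. For a closed set $X$, a set $Z\subseteq X$ is a component of $X$ if $G^{\mathrm{feet}}[Z]$ is a connected component of $G^{\mathrm{feet}}[X]$.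
   Formalization: The graph G also has $N_G(\mathfrak v)\neq\emptyset$ for every $\mathfrak v\in V$ and $|N_G(\mathfrak v)|\neq 2$ for every neighbour $\mathfrak v$ of $\mathfrak u$. The paper assumes this as well. -}

module Defs where

open import Data.Nat using (ℕ; zero; suc; _≤_; _≤?_)
open import Data.Fin using (Fin)
open import Data.Fin.Subset using (Subset; _∈_; _⊆_; _∪_; _─_; ⋃; ∣_∣)
open import Data.List using (List; map; filter; allFin)
open import Data.Empty using (⊥)
open import Data.Sum using (_⊎_; inj₁; inj₂)
open import Data.Product using (_×_; ∃)
open import Relation.Binary.PropositionalEquality using (_≡_)

-- A bipartite graph G = (V, W, E) with V = Fin m, W = Fin n is given by
-- its neighbourhood map  N : Fin m → Subset n  (N v = N_G(v) ⊆ W).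

module _ {m n : ℕ} (N : Fin m → Subset n) where

  Att : Subset n → Subset n
  Att X = X ∪ ⋃ (map N (filter (λ v → ∣ N v ─ X ∣ ≤? 1) (allFin m)))

  Closed : Subset n → Set
  Closed X = X ≡ Att X

  IsClosure : Subset n → Subset n → Set
  IsClosure X C = Closed C × X ⊆ C
                × (∀ C′ → Closed C′ → X ⊆ C′ → C′ ⊆ C → C ≡ C′)

  Vtx : Set
  Vtx = Fin m ⊎ Fin n

  Adj : Vtx → Vtx → Set
  Adj (inj₁ v) (inj₁ v′) = ⊥
  Adj (inj₁ v) (inj₂ w) = w ∈ N v
  Adj (inj₂ w) (inj₁ v) = w ∈ N v
  Adj (inj₂ w) (inj₂ w′) = ⊥

  data Walk (R : Vtx → Vtx → Set) : ℕ → Vtx → Vtx → Set where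
    nil  : ∀ {a} → Walk R zero a a
    cons : ∀ {k a b c} → R a b → Walk R k b c → Walk R (suc k) a c

  DistAtLeast : ℕ → Fin n → Subset n → Set
  DistAtLeast d w Y = ∀ y → y ∈ Y → ∀ k → Walk Adj k (inj₂ w) (inj₂ y) → d ≤ k

  AdjIn : (Vtx → Set) → Vtx → Vtx → Set
  AdjIn S a b = S a × S b × Adj a b

  FeetVtx : Subset n → Vtx → Set
  FeetVtx X (inj₁ v) = N v ⊆ X
  FeetVtx X (inj₂ w) = w ∈ X

  IsConnectedComponent : (H S : Vtx → Set) → Set
  IsConnectedComponent H S =
      (∀ a → S a → H a)
    × ∃ S
    × (∀ a b → S a → S b → ∃ λ k → Walk (AdjIn S) k a b)
    × (∀ a b → S a → H b → Adj a b → S b)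

  IsComponent : Subset n → Subset n → Set
  IsComponent X Z = Z ⊆ X × IsConnectedComponent (FeetVtx X) (FeetVtx Z)

{-# OPTIONS --safe #-}
-- Distance at least 3 already means that no vertex of V is adjacent to both u
-- and Y.  Let v have at most one neighbour outside Y ∪ {u}.  If u ∉ N(v), then v
-- also has at most one neighbour outside Y, so N(v) ⊆ Y as Y is closed.  If
-- u ∈ N(v), then every other neighbour of v lies outside Y ∪ {u}, so |N(v)| ≤ 2,
-- and since |N(v)| ≠ 2 we get N(v) = {u}.  Hence Y ∪ {u} is closed.  The feet of
-- {u} are the v with N(v) = {u}, so G^feet[{u}] is a star centred at u, and an
-- edge of G^feet[Y ∪ {u}] leaving u ends at a v ∋ u, whose neighbourhood must
-- then be {u}.
module Submission where

open import Defs
open import Data.Bool using (true; false)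
open import Data.Empty using (⊥-elim)
open import Data.Fin using (Fin; zero; suc)
open import Data.Fin.Properties using (_≟_)
open import Data.Fin.Subset
  using (Subset; _∈_; _∉_; _⊆_; _∩_; _∪_; _─_; _-_; ⁅_⁆; ⋃; ∣_∣; Nonempty; outside)
open import Data.Fin.Subset.Properties
open import Data.List using (List; []; _∷_; map; filter; allFin)
import Data.List.Membership.Propositional as List
open import Data.List.Membership.Propositional.Properties
  using (∈-map⁺; ∈-map⁻; ∈-filter⁺; ∈-filter⁻; ∈-allFin)
open import Data.List.Relation.Unary.Any as Any using ()
open import Data.Nat using (ℕ; suc; _+_; _≤_; _<_; _≤?_; z≤n; s≤s)
open import Data.Nat.Properties using (≤-reflexive; ≤-trans; ≤-antisym; n≤1+n)
open import Data.Product using (_×_; _,_; ∃-syntax; proj₂)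
open import Data.Sum using (inj₁; inj₂)
open import Data.Vec using (_∷_; here; there)
open import Relation.Binary.PropositionalEquality using (_≡_; _≢_; ≢-sym; refl; cong; subst; sym; trans)
open import Relation.Nullary using (Dec; yes; no; contradiction)

private
  variable
    n : ℕ
    x y : Fin n
    p q r : Subset n

x∈⋃⁺ : ∀ {ps : List (Subset n)} → p List.∈ ps → x ∈ p → x ∈ ⋃ ps
x∈⋃⁺ (Any.here refl) x∈p = x∈p∪q⁺ (inj₁ x∈p)
x∈⋃⁺ (Any.there p∈ps) x∈p = x∈p∪q⁺ (inj₂ (x∈⋃⁺ p∈ps x∈p))

x∈⋃⁻ : ∀ (ps : List (Subset n)) → x ∈ ⋃ ps → ∃[ p ] p List.∈ ps × x ∈ p
x∈⋃⁻ [] x∈⊥ = ⊥-elim (∉⊥ x∈⊥)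
x∈⋃⁻ (p ∷ ps) x∈⋃ with x∈p∪q⁻ p (⋃ ps) x∈⋃
... | inj₁ x∈p = p , Any.here refl , x∈p
... | inj₂ x∈⋃ps with x∈⋃⁻ ps x∈⋃ps
...   | q , q∈ps , x∈q = q , Any.there q∈ps , x∈q

x∈p─q⇒x∉q : ∀ (p q : Subset n) → x ∈ p ─ q → x ∉ q
x∈p─q⇒x∉q (_ ∷ p) (outside ∷ q) here ()
x∈p─q⇒x∉q (_ ∷ p) (_ ∷ q) (there x∈p─q) (there x∈q) = x∈p─q⇒x∉q p q x∈p─q x∈q

p∩r⊆q⇒p─q⊆p─r : p ∩ r ⊆ q → p ─ q ⊆ p ─ r
p∩r⊆q⇒p─q⊆p─r {p = p} {q = q} p∩r⊆q {x} x∈p─q =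
  x∈p∧x∉q⇒x∈p─q x∈p (λ x∈r → x∈p─q⇒x∉q p q x∈p─q (p∩r⊆q (x∈p∩q⁺ (x∈p , x∈r))))
  where
  x∈p : x ∈ p
  x∈p = p─q⊆p p q x∈p─q

∣p∣≤suc∣p-x∣ : ∀ (p : Subset n) x → ∣ p ∣ ≤ suc ∣ p - x ∣
∣p∣≤suc∣p-x∣ (true  ∷ p) zero    = s≤s (≤-reflexive (cong ∣_∣ (sym (p─⊥≡p p))))
∣p∣≤suc∣p-x∣ (false ∷ p) zero    = ≤-trans (n≤1+n _) (s≤s (≤-reflexive (cong ∣_∣ (sym (p─⊥≡p p)))))
∣p∣≤suc∣p-x∣ (true  ∷ p) (suc x) = s≤s (∣p∣≤suc∣p-x∣ p x)
∣p∣≤suc∣p-x∣ (false ∷ p) (suc x) = ∣p∣≤suc∣p-x∣ p x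

x∈p∧y∈p∧x≢y⇒2≤∣p∣ : x ∈ p → y ∈ p → x ≢ y → 2 ≤ ∣ p ∣
x∈p∧y∈p∧x≢y⇒2≤∣p∣ x∈p y∈p x≢y =
  ≤-trans (s≤s (≤-trans (s≤s z≤n) (x∈p⇒∣p-x∣<∣p∣ (x∈p∧x≢y⇒x∈p-y y∈p (≢-sym x≢y)))))
          (x∈p⇒∣p-x∣<∣p∣ x∈p)

0<∣p∣⇒Nonempty : ∀ {n} {p : Subset n} → 0 < ∣ p ∣ → Nonempty p
0<∣p∣⇒Nonempty {n = n} {p = p} 0<∣p∣ with nonempty? p
... | yes p≢∅ = p≢∅
... | no p≡∅ = contradiction (subst (0 <_) ∣p∣≡0 0<∣p∣) λ ()
  where
  ∣p∣≡0 : ∣ p ∣ ≡ 0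
  ∣p∣≡0 = trans (cong ∣_∣ (Empty-unique p≡∅)) (∣⊥∣≡0 n)

Nonempty∧p⊆⁅x⁆⇒x∈p : Nonempty p → p ⊆ ⁅ x ⁆ → x ∈ p
Nonempty∧p⊆⁅x⁆⇒x∈p {p = p} {x = x} (y , y∈p) p⊆⁅x⁆ =
  subst (_∈ p) (x∈⁅y⁆⇒x≡y x (p⊆⁅x⁆ y∈p)) y∈p

module _ {m n : ℕ} (N : Fin m → Subset n) where

  _++ʷ_ : ∀ {R k l a b c} → Walk N R k a b → Walk N R l b c → Walk N R (k + l) a c
  nil      ++ʷ q = q
  cons r p ++ʷ q = cons r (p ++ʷ q)

  attracts? : ∀ X v → Dec (∣ N v ─ X ∣ ≤ 1)
  attracts? X v = ∣ N v ─ X ∣ ≤? 1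

  Absorbing : Subset n → Set
  Absorbing X = ∀ v → ∣ N v ─ X ∣ ≤ 1 → N v ⊆ X

  N⊆Att : ∀ X v → ∣ N v ─ X ∣ ≤ 1 → N v ⊆ Att N X
  N⊆Att X v ∣Nv─X∣≤1 x∈Nv = x∈p∪q⁺ (inj₂ (x∈⋃⁺ (∈-map⁺ N v∈attracting) x∈Nv))
    where
    v∈attracting : v List.∈ filter (attracts? X) (allFin m)
    v∈attracting = ∈-filter⁺ (attracts? X) (∈-allFin v) ∣Nv─X∣≤1

  Absorbing⇒Att⊆ : ∀ {X} → Absorbing X → Att N X ⊆ X
  Absorbing⇒Att⊆ {X} absorbing x∈Att with x∈p∪q⁻ X _ x∈Att
  ... | inj₁ x∈X = x∈X
  ... | inj₂ x∈⋃ with x∈⋃⁻ (map N (filter (attracts? X) (allFin m))) x∈⋃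
  ...   | _ , p∈ps , x∈p with ∈-map⁻ N p∈ps
  ...     | v , v∈attracting , refl =
    absorbing v (proj₂ (∈-filter⁻ (attracts? X) {xs = allFin m} v∈attracting)) x∈p

  Closed⇒Absorbing : ∀ {X} → Closed N X → Absorbing X
  Closed⇒Absorbing {X} closed v ∣Nv─X∣≤1 {x} x∈Nv =
    subst (x ∈_) (sym closed) (N⊆Att X v ∣Nv─X∣≤1 x∈Nv)

  Absorbing⇒Closed : ∀ {X} → Absorbing X → Closed N X
  Absorbing⇒Closed absorbing = ⊆-antisym (p⊆p∪q _) (Absorbing⇒Att⊆ absorbing)

  Closed⇒IsClosure : ∀ {X} → Closed N X → IsClosure N X X
  Closed⇒IsClosure closed = closed , ⊆-refl , λ _ _ X⊆C′ C′⊆X → ⊆-antisym X⊆C′ C′⊆X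

  FeetVtx-mono : ∀ {X X′} → X ⊆ X′ → ∀ a → FeetVtx N X a → FeetVtx N X′ a
  FeetVtx-mono X⊆X′ (inj₁ v) Nv⊆X = ⊆-trans Nv⊆X X⊆X′
  FeetVtx-mono X⊆X′ (inj₂ w) w∈X = X⊆X′ w∈X

  NoCommonNeighbour : Fin n → Subset n → Set
  NoCommonNeighbour u Y = ∀ {v w} → u ∈ N v → w ∈ N v → w ∉ Y

  DistAtLeast⇒NoCommonNeighbour : ∀ {d u Y} → 3 ≤ d → DistAtLeast N d u Y → NoCommonNeighbour u Y
  DistAtLeast⇒NoCommonNeighbour 3≤d far {v} {w} u∈Nv w∈Nv w∈Y
    with ≤-trans 3≤d (far w w∈Y 2 (cons {b = inj₁ v} u∈Nv (cons {b = inj₂ w} w∈Nv nil)))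
  ... | s≤s (s≤s ())

  module _ {Y : Subset n} {u : Fin n} where

    NoCommonNeighbour⇒N∩[Y∪⁅u⁆]⊆⁅u⁆ : NoCommonNeighbour u Y → ∀ {v} → u ∈ N v → N v ∩ (Y ∪ ⁅ u ⁆) ⊆ ⁅ u ⁆
    NoCommonNeighbour⇒N∩[Y∪⁅u⁆]⊆⁅u⁆ separated {v} u∈Nv z∈ with x∈p∩q⁻ (N v) _ z∈
    ... | z∈Nv , z∈Y∪⁅u⁆ with x∈p∪q⁻ Y ⁅ u ⁆ z∈Y∪⁅u⁆
    ...   | inj₁ z∈Y = contradiction z∈Y (separated u∈Nv z∈Nv)
    ...   | inj₂ z∈⁅u⁆ = z∈⁅u⁆

    N∌u⇒N∩[Y∪⁅u⁆]⊆Y : ∀ {v} → u ∉ N v → N v ∩ (Y ∪ ⁅ u ⁆) ⊆ Y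
    N∌u⇒N∩[Y∪⁅u⁆]⊆Y {v} u∉Nv z∈ with x∈p∩q⁻ (N v) _ z∈
    ... | z∈Nv , z∈Y∪⁅u⁆ with x∈p∪q⁻ Y ⁅ u ⁆ z∈Y∪⁅u⁆
    ...   | inj₁ z∈Y = z∈Y
    ...   | inj₂ z∈⁅u⁆ = contradiction (subst (_∈ N v) (x∈⁅y⁆⇒x≡y u z∈⁅u⁆) z∈Nv) u∉Nv

    absorbed-into-Y : Closed N Y → ∀ {v} → u ∉ N v → ∣ N v ─ (Y ∪ ⁅ u ⁆) ∣ ≤ 1 → N v ⊆ Y
    absorbed-into-Y closed {v} u∉Nv ∣Nv─X∣≤1 =
      Closed⇒Absorbing closed v (≤-trans ∣Nv─Y∣≤∣Nv─X∣ ∣Nv─X∣≤1)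
      where
      ∣Nv─Y∣≤∣Nv─X∣ : ∣ N v ─ Y ∣ ≤ ∣ N v ─ (Y ∪ ⁅ u ⁆) ∣
      ∣Nv─Y∣≤∣Nv─X∣ = p⊆q⇒∣p∣≤∣q∣ (p∩r⊆q⇒p─q⊆p─r (N∌u⇒N∩[Y∪⁅u⁆]⊆Y u∉Nv))

    absorbed-into-u : NoCommonNeighbour u Y → ∀ {v} → ∣ N v ∣ ≢ 2 → u ∈ N v →
                      ∣ N v ─ (Y ∪ ⁅ u ⁆) ∣ ≤ 1 → N v ⊆ ⁅ u ⁆
    absorbed-into-u separated {v} ∣Nv∣≢2 u∈Nv ∣Nv─X∣≤1 {x} x∈Nv with x ≟ u
    ... | yes refl = x∈⁅x⁆ x
    ... | no x≢u = contradiction (≤-antisym ∣Nv∣≤2 (x∈p∧y∈p∧x≢y⇒2≤∣p∣ x∈Nv u∈Nv x≢u)) ∣Nv∣≢2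
      where
      ∣Nv-u∣≤∣Nv─X∣ : ∣ N v - u ∣ ≤ ∣ N v ─ (Y ∪ ⁅ u ⁆) ∣
      ∣Nv-u∣≤∣Nv─X∣ = p⊆q⇒∣p∣≤∣q∣ (p∩r⊆q⇒p─q⊆p─r (NoCommonNeighbour⇒N∩[Y∪⁅u⁆]⊆⁅u⁆ separated u∈Nv))
      ∣Nv∣≤2 : ∣ N v ∣ ≤ 2
      ∣Nv∣≤2 = ≤-trans (∣p∣≤suc∣p-x∣ (N v) u) (s≤s (≤-trans ∣Nv-u∣≤∣Nv─X∣ ∣Nv─X∣≤1))

    Absorbing-Y∪⁅u⁆ : Closed N Y → NoCommonNeighbour u Y → (∀ v → u ∈ N v → ∣ N v ∣ ≢ 2) →
                      Absorbing (Y ∪ ⁅ u ⁆)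
    Absorbing-Y∪⁅u⁆ closed separated deg≢2 v ∣Nv─X∣≤1 with u ∈? N v
    ... | yes u∈Nv = ⊆-trans (absorbed-into-u separated (deg≢2 v u∈Nv) u∈Nv ∣Nv─X∣≤1) (q⊆p∪q Y ⁅ u ⁆)
    ... | no u∉Nv = ⊆-trans (absorbed-into-Y closed u∉Nv ∣Nv─X∣≤1) (p⊆p∪q ⁅ u ⁆)

    module Star (nonempty : ∀ v → 1 ≤ ∣ N v ∣) where

      S : Vtx N → Set
      S = FeetVtx N ⁅ u ⁆

      spoke : ∀ {v} → N v ⊆ ⁅ u ⁆ → AdjIn N S (inj₁ v) (inj₂ u)
      spoke {v} Nv⊆⁅u⁆ = (λ {z} → Nv⊆⁅u⁆) , x∈⁅x⁆ u , Nonempty∧p⊆⁅x⁆⇒x∈p (0<∣p∣⇒Nonempty (nonempty v)) Nv⊆⁅u⁆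

      to-centre : ∀ a → S a → ∃[ k ] Walk N (AdjIn N S) k a (inj₂ u)
      to-centre (inj₁ v) Nv⊆⁅u⁆ = 1 , cons (spoke Nv⊆⁅u⁆) nil
      to-centre (inj₂ w) w∈⁅u⁆ with x∈⁅y⁆⇒x≡y u w∈⁅u⁆
      ... | refl = 0 , nil

      from-centre : ∀ a → S a → ∃[ k ] Walk N (AdjIn N S) k (inj₂ u) a
      from-centre (inj₁ v) Nv⊆⁅u⁆ with spoke Nv⊆⁅u⁆
      ... | Sv , Su , u∈Nv = 1 , cons (Su , (λ {z} → Sv) , u∈Nv) nil
      from-centre (inj₂ w) w∈⁅u⁆ with x∈⁅y⁆⇒x≡y u w∈⁅u⁆
      ... | refl = 0 , nil

      connected : ∀ a b → S a → S b → ∃[ k ] Walk N (AdjIn N S) k a b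
      connected a b Sa Sb with to-centre a Sa | from-centre b Sb
      ... | k , a→u | l , u→b = k + l , a→u ++ʷ u→b

      maximal : NoCommonNeighbour u Y → ∀ a b → S a → FeetVtx N (Y ∪ ⁅ u ⁆) b → Adj N a b → S b
      maximal _ (inj₁ v) (inj₂ w) Nv⊆⁅u⁆ _ w∈Nv = Nv⊆⁅u⁆ w∈Nv
      maximal separated (inj₂ w) (inj₁ v) w∈⁅u⁆ Nv⊆X w∈Nv with x∈⁅y⁆⇒x≡y u w∈⁅u⁆
      ... | refl = λ z∈Nv → NoCommonNeighbour⇒N∩[Y∪⁅u⁆]⊆⁅u⁆ separated w∈Nv (x∈p∩q⁺ (z∈Nv , Nv⊆X z∈Nv))

    ⁅u⁆-IsComponent : (∀ v → 1 ≤ ∣ N v ∣) → NoCommonNeighbour u Y → IsComponent N (Y ∪ ⁅ u ⁆) ⁅ u ⁆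
    ⁅u⁆-IsComponent nonempty separated =
      q⊆p∪q Y ⁅ u ⁆ , FeetVtx-mono (q⊆p∪q Y ⁅ u ⁆) , (inj₂ u , x∈⁅x⁆ u) , connected , maximal separated
      where open Star nonempty

lemma7p10 : ∀ {m n : ℕ} (N : Fin m → Subset n) (Y : Subset n) (u : Fin n)
    → (∀ v → 1 ≤ ∣ N v ∣)
    → (∀ v → u ∈ N v → ∣ N v ∣ ≢ 2)
    → Closed N Y
    → DistAtLeast N 4 u Y
    → IsClosure N (Y ∪ ⁅ u ⁆) (Y ∪ ⁅ u ⁆) × IsComponent N (Y ∪ ⁅ u ⁆) ⁅ u ⁆
lemma7p10 N Y u nonempty deg≢2 closed far =
    Closed⇒IsClosure N (Absorbing⇒Closed N (Absorbing-Y∪⁅u⁆ N closed separated deg≢2))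
  , ⁅u⁆-IsComponent N nonempty separated
  where
  separated : NoCommonNeighbour N u Y
  separated = DistAtLeast⇒NoCommonNeighbour N (s≤s (s≤s (s≤s z≤n))) far
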